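{- Let $N$ and $H$ be finite groups with $|N|=m$, $|H|=d$, let $\theta:H\to\mathrm{Aut}(N)$ be a homomorphism, $G=N\rtimes_\theta H$, and $N_1\subseteq N\setminus\{e_N\}$. Suppose that in $\mathbb{Z}[N]$ $$\overline{N_1^\flat}=x_1\overline{N}+x_2e_N$$ for some integers $x_1,x_2$ with $d>x_1>0$ and $x_2<0$. Then the Cayley graph $\mathcal{C}(G,N_1\times H)$ is a directed strongly regular graph with parameters $$\left(md,\;x_1m+x_2,\;\frac{x_1(x_1m+x_2)}{d},\;x_2+\frac{x_1(x_1m+x_2)}{d},\;\frac{x_1(x_1m+x_2)}{d}\right).$$
   Context: $N\rtimes_\theta H$ is $N\times H$ with product $(n,h)(n',h')=(n\,\theta(h)(n'),hh')$, with $N,H$ identified with $N\times\{e_H\}$, $\{e_N\}\times H$; $N_1\times H=\{(n,h):n\in N_1,h\in H\}$. For $S\subseteq G\setminus\{e\}$, $\mathcal{C}(G,S)$ has vertex set $G$ and an arc $x\to y$ iff $yx^{ -1}\in S$. A directed graph on $n$ vertices with $0/1$ adjacency matrix $A$ (zero diagonal) is a directed strongly regular graph with parameters $(n,k,\mu,\lambda,t)$ (in this order) if $JA=AJ=kJ$ and $A^2=tI+\lambda A+\mu(J-I-A)$, $J$ the all-ones matrix. $\overline{N}=\sum_{n\in N}n$, and $N_1^\flat$ is the multiset on $N$ with $\overline{N_1^\flat}=\sum_{h\in H}h\overline{N_1}h^{ -1}=\sum_{h\in H}\sum_{n_1\in N_1}\theta(h)(n_1)$. -}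

module Defs where

open import Level using (0ℓ)
open import Data.Nat as ℕ using (ℕ; zero; suc)
open import Data.Integer as ℤ using (ℤ; +_; _+_; _*_; _-_)
open import Data.Bool using (Bool; true; false; if_then_else_; _∧_)
open import Data.Fin using (Fin; remQuot) renaming (zero to fz; suc to fs)
open import Data.Fin.Properties using (_≟_)
open import Data.Fin.Subset using (Subset)
open import Data.Vec using (lookup)
open import Data.Product using (_×_; _,_)
open import Relation.Nullary.Decidable using (⌊_⌋)
open import Relation.Binary.PropositionalEquality using (_≡_)
open import Algebra.Structures using (IsGroup)
open import Algebra.Bundles.Raw using (RawGroup)
open import Algebra.Morphism.Structures using (module GroupMorphisms)

record FinGroup (m : ℕ) : Set where
  infixl 7 _∙_
  infix  8 _⁻¹
  field
    _∙_     : Fin m → Fin m → Fin m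
    ε       : Fin m
    _⁻¹     : Fin m → Fin m
    isGroup : IsGroup _≡_ _∙_ ε _⁻¹

  rawGroup : RawGroup 0ℓ 0ℓ
  rawGroup = record { Carrier = Fin m ; _≈_ = _≡_ ; _∙_ = _∙_ ; ε = ε ; _⁻¹ = _⁻¹ }

open FinGroup

IsAutomorphism : ∀ {m} (N : FinGroup m) → (Fin m → Fin m) → Set
IsAutomorphism N f = GroupMorphisms.IsGroupIsomorphism (rawGroup N) (rawGroup N) f

IsAutAction : ∀ {m d} (N : FinGroup m) (H : FinGroup d) → (Fin d → Fin m → Fin m) → Set
IsAutAction N H θ =
  (∀ h → IsAutomorphism N (θ h)) ×
  (∀ h h' n → θ (_∙_ H h h') n ≡ θ h (θ h' n))

sdMul : ∀ {m d} (N : FinGroup m) (H : FinGroup d) (θ : Fin d → Fin m → Fin m) →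
        Fin m × Fin d → Fin m × Fin d → Fin m × Fin d
sdMul N H θ (n , h) (n' , h') = (_∙_ N n (θ h n') , _∙_ H h h')

sdInv : ∀ {m d} (N : FinGroup m) (H : FinGroup d) (θ : Fin d → Fin m → Fin m) →
        Fin m × Fin d → Fin m × Fin d
sdInv N H θ (n , h) = (θ (_⁻¹ H h) (_⁻¹ N n) , _⁻¹ H h)

inN₁×H : ∀ {m d} → Subset m → Fin m × Fin d → Bool
inN₁×H N₁ (n , h) = lookup N₁ n

-- Cayley digraph C(G, N₁ × H), G = N ⋊_θ H: arc x → y iff y x⁻¹ ∈ N₁ × H.
cayleyArc : ∀ {m d} (N : FinGroup m) (H : FinGroup d) (θ : Fin d → Fin m → Fin m) →
            Subset m → Fin m × Fin d → Fin m × Fin d → Bool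
cayleyArc N H θ N₁ x y = inN₁×H N₁ (sdMul N H θ y (sdInv N H θ x))

cayleyArcFin : ∀ {m d} (N : FinGroup m) (H : FinGroup d) (θ : Fin d → Fin m → Fin m) →
               Subset m → Fin (m ℕ.* d) → Fin (m ℕ.* d) → Bool
cayleyArcFin {m} {d} N H θ N₁ i j = cayleyArc N H θ N₁ (remQuot {m} d i) (remQuot {m} d j)

Σℤ : ∀ {k} → (Fin k → ℤ) → ℤ
Σℤ {zero}  f = + 0
Σℤ {suc k} f = f fz + Σℤ (λ i → f (fs i))

count : ∀ {k} → (Fin k → Bool) → ℕ
count {zero}  p = 0
count {suc k} p = (if p fz then 1 else 0) ℕ.+ count (λ i → p (fs i))

[_] : Bool → ℤ
[ b ] = if b then + 1 else + 0

-- Coefficient of n in the multiset N₁♭ = Σ_{h∈H} Σ_{n₁∈N₁} θ(h)(n₁), element of ℤ[N]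
flatCoeff : ∀ {m d} → (Fin d → Fin m → Fin m) → Subset m → Fin m → ℤ
flatCoeff θ N₁ n = Σℤ (λ h → + count (λ n₁ → lookup N₁ n₁ ∧ ⌊ θ h n₁ ≟ n ⌋))

-- Directed strongly regular graph with parameters (n, k, μ, λ, t) on vertex set Fin n,
-- given by its arc relation; A is its 0/1 adjacency matrix (zero diagonal), J all-ones.
record IsDSRG (n : ℕ) (arc : Fin n → Fin n → Bool) (k μ λ' t : ℤ) : Set where
  A : Fin n → Fin n → ℤ
  A x y = [ arc x y ]
  I : Fin n → Fin n → ℤ
  I x y = [ ⌊ x ≟ y ⌋ ]
  field
    zeroDiag : ∀ x → arc x x ≡ false
    JA≡kJ    : ∀ y → Σℤ (λ z → A z y) ≡ k
    AJ≡kJ    : ∀ x → Σℤ (λ z → A x z) ≡ k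
    A²       : ∀ x y → Σℤ (λ z → A x z * A z y)
                       ≡ t * I x y + λ' * A x y + μ * (+ 1 - I x y - A x y)

-- In a Cayley digraph C(G, S) every vertex has in- and out-degree |S|, and the
-- 2-paths from x to y correspond to the s ∈ S with (y x⁻¹) s⁻¹ ∈ S.  For
-- G = N ⋊ H and S = N₁ × H the H-coordinate of s can be summed out: if
-- y x⁻¹ = (c, l), the number of 2-paths is the coefficient of c in the group-ring
-- product N₁ · N₁♭, which the hypothesis evaluates to x₁ |N₁| + x₂ [c ∈ N₁].
-- Summing the hypothesis over N gives d |N₁| = x₁ m + x₂, whence
-- A² = μ J + x₂ A with μ = x₁ |N₁| = x₁ (x₁ m + x₂) / d.
module Submission where

open import Level using (0ℓ)
open import Data.Nat as ℕ using (ℕ; NonZero; zero; suc)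
import Data.Nat.DivMod as ℕ
open import Data.Integer using (ℤ; +_; _+_; _*_; _-_; _/_; _<_; _≤_; +≤+)
open import Data.Integer.Properties
  using (+-*-semiring; *-identityˡ; *-identityʳ; *-zeroˡ; *-comm; *-assoc; *-distribʳ-+; +-identityˡ; +-identityʳ;
         +-assoc; pos-*; <⇒≤)
open import Data.Integer.Tactic.RingSolver using (solve-∀)
open import Data.Bool using (Bool; true; false; _∧_)
open import Data.Bool.Properties using (¬-not)
open import Data.Fin using (Fin; remQuot; combine; _↑ˡ_; _↑ʳ_) renaming (zero to fz; suc to fs)
open import Data.Fin.Properties using (_≟_; suc-injective; remQuot-combine; *↔×)
open import Data.Fin.Permutation using (permutation)
open import Data.Fin.Subset using (Subset; _∉_)
open import Data.Vec using (lookup)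
open import Data.Vec.Properties using (lookup⇒[]=)
open import Data.Product using (_×_; _,_; proj₁; proj₂)
open import Function using (_⇔_; mk⇔; _↔_; Inverse)
open import Relation.Nullary.Decidable using (Dec; ⌊_⌋; isYes≗does; does-⇔)
open import Relation.Binary.PropositionalEquality
  using (_≡_; refl; sym; trans; cong; cong₂; isEquivalence; module ≡-Reasoning)
open import Algebra.Bundles using (Group)
open import Algebra.Structures using (IsGroup)
open import Algebra.Morphism.Structures using (module GroupMorphisms)
import Algebra.Morphism.GroupMonomorphism as GroupMonomorphism
import Algebra.Properties.Group as GroupProperties
import Algebra.Properties.Loop as LoopProperties
open import Algebra.Properties.Semiring.Sum +-*-semiring
  using (sum; sum-syntax; sum-cong-≗; sum-replicate-zero; ∑-comm; ∑-distrib-+; ∑-permute; *-distribˡ-sum)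
open import Defs

a*[b*c]≡b*[c*a] : ∀ a b c → a * (b * c) ≡ b * (c * a)
a*[b*c]≡b*[c*a] = solve-∀

a*[b+c*d]≡b*a+c*[d*a] : ∀ a b c d → a * (b + c * d) ≡ b * a + c * (d * a)
a*[b+c*d]≡b*a+c*[d*a] = solve-∀

tI+[x+t]A+t[1-I-A]≡t+xA : ∀ t x I A → t * I + (x + t) * A + t * (+ 1 - I - A) ≡ t + x * A
tI+[x+t]A+t[1-I-A]≡t+xA = solve-∀

i*[d*b]/d≡i*b : ∀ {i} d b .{{_ : NonZero d}} → + 0 ≤ i → (i * (+ d * + b)) / + d ≡ i * + b
i*[d*b]/d≡i*b {+ a} d b (+≤+ _) = begin
  (+ a * (+ d * + b)) / + d  ≡⟨ cong (λ t → (+ a * t) / + d) (*-comm (+ d) (+ b)) ⟩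
  (+ a * (+ b * + d)) / + d  ≡⟨ cong (_/ + d) (*-assoc (+ a) (+ b) (+ d)) ⟨
  (+ a * + b * + d) / + d    ≡⟨ cong (λ t → (t * + d) / + d) (sym (pos-* a b)) ⟩
  (+ (a ℕ.* b) * + d) / + d  ≡⟨ cong (_/ + d) (sym (pos-* (a ℕ.* b) d)) ⟩
  + (a ℕ.* b ℕ.* d) / + d    ≡⟨ *-identityˡ _ ⟩  -- i / + d unfolds to + 1 * (i /ℕ d)
  + (a ℕ.* b ℕ.* d ℕ./ d)    ≡⟨ cong +_ (ℕ.m*n/n≡m (a ℕ.* b) d) ⟩
  + (a ℕ.* b)                ≡⟨ pos-* a b ⟩
  + a * + b                  ∎
  where open ≡-Reasoning

⌊⌋-cong-⇔ : ∀ {P Q : Set} (p? : Dec P) (q? : Dec Q) → P ⇔ Q → ⌊ p? ⌋ ≡ ⌊ q? ⌋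
⌊⌋-cong-⇔ p? q? P⇔Q = trans (isYes≗does p?) (trans (does-⇔ P⇔Q p? q?) (sym (isYes≗does q?)))

[∧]≡[]*[] : ∀ a b → [ a ∧ b ] ≡ [ a ] * [ b ]
[∧]≡[]*[] true  b = sym (*-identityˡ [ b ])
[∧]≡[]*[] false b = refl

∉⇒lookup≡false : ∀ {n} {p : Subset n} {x} → x ∉ p → lookup p x ≡ false
∉⇒lookup≡false {p = p} {x} x∉p = ¬-not (λ eq → x∉p (lookup⇒[]= x p eq))

Σℤ≡sum : ∀ {k} (f : Fin k → ℤ) → Σℤ f ≡ sum f
Σℤ≡sum {zero}  f = refl
Σℤ≡sum {suc k} f = cong (λ s → f fz + s) (Σℤ≡sum (λ i → f (fs i)))

count≡∑ : ∀ {k} (p : Fin k → Bool) → + count p ≡ ∑[ i < k ] [ p i ]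
count≡∑ {zero}  p = refl
count≡∑ {suc k} p with p fz
... | true  = cong (λ s → + 1 + s) (count≡∑ (λ i → p (fs i)))
... | false = cong (λ s → + 0 + s) (count≡∑ (λ i → p (fs i)))

∑-const : ∀ k c → ∑[ i < k ] c ≡ + k * c
∑-const zero    c = sym (*-zeroˡ c)
∑-const (suc k) c = begin
  c + ∑[ i < k ] c   ≡⟨ cong₂ _+_ (sym (*-identityˡ c)) (∑-const k c) ⟩
  + 1 * c + + k * c  ≡⟨ *-distribʳ-+ c (+ 1) (+ k) ⟨
  + suc k * c        ∎
  where open ≡-Reasoning

∑-δ : ∀ {k} (j : Fin k) (f : Fin k → ℤ) → ∑[ i < k ] ([ ⌊ i ≟ j ⌋ ] * f i) ≡ f j
∑-δ {suc k} fz f = begin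
  + 1 * f fz + ∑[ i < k ] (+ 0 * f (fs i))
    ≡⟨ cong₂ _+_ (*-identityˡ (f fz)) (sum-cong-≗ λ i → *-zeroˡ (f (fs i))) ⟩
  f fz + ∑[ i < k ] (+ 0)
    ≡⟨ cong (λ s → f fz + s) (sum-replicate-zero k) ⟩
  f fz + + 0
    ≡⟨ +-identityʳ (f fz) ⟩
  f fz
    ∎
  where open ≡-Reasoning
∑-δ {suc k} (fs j) f = begin
  + 0 * f fz + ∑[ i < k ] ([ ⌊ fs i ≟ fs j ⌋ ] * f (fs i))
    ≡⟨ cong₂ _+_ (*-zeroˡ (f fz)) (sum-cong-≗ λ i → cong (λ b → [ b ] * f (fs i)) (fs≟fs≡≟ i)) ⟩
  + 0 + ∑[ i < k ] ([ ⌊ i ≟ j ⌋ ] * f (fs i))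
    ≡⟨ +-identityˡ _ ⟩
  ∑[ i < k ] ([ ⌊ i ≟ j ⌋ ] * f (fs i))
    ≡⟨ ∑-δ j (λ i → f (fs i)) ⟩
  f (fs j)
    ∎
  where
  open ≡-Reasoning
  fs≟fs≡≟ : ∀ i → ⌊ fs i ≟ fs j ⌋ ≡ ⌊ i ≟ j ⌋
  fs≟fs≡≟ i = ⌊⌋-cong-⇔ (fs i ≟ fs j) (i ≟ j) (mk⇔ suc-injective (cong fs))

∑-indicator : ∀ {k} {P : Fin k → Set} (P? : ∀ i → Dec (P i)) (j : Fin k) → (∀ i → P i ⇔ i ≡ j) →
              (f : Fin k → ℤ) → ∑[ i < k ] ([ ⌊ P? i ⌋ ] * f i) ≡ f j
∑-indicator P? j P⇔≡j f =
  trans (sum-cong-≗ λ i → cong (λ b → [ b ] * f i) (⌊⌋-cong-⇔ (P? i) (i ≟ j) (P⇔≡j i))) (∑-δ j f)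

∑-reindex : ∀ {k} (σ τ : Fin k → Fin k) → (∀ i → σ (τ i) ≡ i) → (∀ i → τ (σ i) ≡ i) →
            (f : Fin k → ℤ) → ∑[ i < k ] f (σ i) ≡ ∑[ i < k ] f i
∑-reindex σ τ στ τσ f = sym (∑-permute f (permutation σ τ στ τσ))

∑-split : ∀ a b (g : Fin (a ℕ.+ b) → ℤ) →
          ∑[ i < a ℕ.+ b ] g i ≡ ∑[ i < a ] g (i ↑ˡ b) + ∑[ j < b ] g (a ↑ʳ j)
∑-split zero    b g = sym (+-identityˡ _)
∑-split (suc a) b g =
  trans (cong (λ s → g fz + s) (∑-split a b (λ i → g (fs i)))) (sym (+-assoc (g fz) _ _))

∑-combine : ∀ m d (g : Fin (m ℕ.* d) → ℤ) →
            ∑[ i < m ℕ.* d ] g i ≡ ∑[ a < m ] ∑[ h < d ] g (combine a h)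
∑-combine zero    d g = refl
∑-combine (suc m) d g = trans (∑-split d (m ℕ.* d) g)
  (cong (λ s → ∑[ h < d ] g (combine {suc m} fz h) + s) (∑-combine m d (λ i → g (d ↑ʳ i))))

∑-remQuot : ∀ m d (f : Fin m × Fin d → ℤ) →
            ∑[ i < m ℕ.* d ] f (remQuot {m} d i) ≡ ∑[ a < m ] ∑[ h < d ] f (a , h)
∑-remQuot m d f =
  trans (∑-combine m d _) (sum-cong-≗ λ a → sum-cong-≗ λ h → cong f (remQuot-combine a h))

module _ {a ℓ} (G : Group a ℓ) where
  open Group G using (_≈_; _//_; _\\_; ∙-congʳ; ∙-congˡ) renaming (trans to ≈-trans)
  open GroupProperties G

  [y//x]\\y≈x : ∀ x y → (y // x) \\ y ≈ x
  [y//x]\\y≈x x y = ≈-trans (∙-congʳ (⁻¹-anti-homo-// y x)) (//-rightDividesˡ y x)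

  y//[x\\y]≈x : ∀ x y → y // (x \\ y) ≈ x
  y//[x\\y]≈x x y = ≈-trans (∙-congˡ (⁻¹-anti-homo-\\ x y)) (\\-leftDividesˡ y x)

toGroup : ∀ {n} → FinGroup n → Group 0ℓ 0ℓ
toGroup G = record { isGroup = FinGroup.isGroup G }

module _ {n} {A : Set} (Fin↔A : Fin n ↔ A) {_◦_ : A → A → A} {e : A} {_⁻¹ : A → A}
         (isGroup : IsGroup _≡_ _◦_ e _⁻¹) where
  open Inverse Fin↔A

  finGroupVia : FinGroup n
  finGroupVia = record
    { _∙_     = λ x y → from (to x ◦ to y)
    ; ε       = from e
    ; _⁻¹     = λ x → from (to x ⁻¹)
    ; isGroup = GroupMonomorphism.isGroup to-isGroupMonomorphism isGroup
    }
    where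
    to-isGroupMonomorphism : GroupMorphisms.IsGroupMonomorphism
      (record { _≈_ = _≡_ ; _∙_ = λ x y → from (to x ◦ to y) ; ε = from e ; _⁻¹ = λ x → from (to x ⁻¹) })
      (record { _≈_ = _≡_ ; _∙_ = _◦_ ; ε = e ; _⁻¹ = _⁻¹ })
      to
    to-isGroupMonomorphism = record
      { isGroupHomomorphism = record
        { isMonoidHomomorphism = record
          { isMagmaHomomorphism = record
            { isRelHomomorphism = record { cong = cong to }
            ; homo              = λ x y → strictlyInverseˡ (to x ◦ to y)
            }
          ; ε-homo = strictlyInverseˡ e
          }
        ; ⁻¹-homo = λ x → strictlyInverseˡ (to x ⁻¹)
        }
      ; injective = λ {x} {y} tx≡ty →
          trans (sym (strictlyInverseʳ x)) (trans (cong from tx≡ty) (strictlyInverseʳ y))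
      }

  to-ε : to (FinGroup.ε finGroupVia) ≡ e
  to-ε = strictlyInverseˡ e

  to-∙-⁻¹ : ∀ x y → to (FinGroup._∙_ finGroupVia y (FinGroup._⁻¹ finGroupVia x)) ≡ to y ◦ (to x ⁻¹)
  to-∙-⁻¹ x y = trans (strictlyInverseˡ _) (cong (to y ◦_) (strictlyInverseˡ (to x ⁻¹)))

module CayleyDigraph {n} (G : FinGroup n) (S : Fin n → Bool) where
  open FinGroup G
  open Group (toGroup G) using (assoc; inverseʳ; _//_; _\\_)
  open GroupProperties (toGroup G)

  arc : Fin n → Fin n → Bool
  arc x y = S (y ∙ x ⁻¹)

  arc-irreflexive : S ε ≡ false → ∀ x → arc x x ≡ false
  arc-irreflexive Sε≡false x = trans (cong S (inverseʳ x)) Sε≡false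

  ∑-∙ʳ : ∀ x (f : Fin n → ℤ) → ∑[ s < n ] f (s ∙ x) ≡ ∑[ z < n ] f z
  ∑-∙ʳ x = ∑-reindex (_∙ x) (_// x) (//-rightDividesˡ x) (//-rightDividesʳ x)

  out-degree : ∀ x → ∑[ z < n ] [ arc x z ] ≡ ∑[ s < n ] [ S s ]
  out-degree x = trans (sym (∑-∙ʳ x (λ z → [ arc x z ])))
                       (sum-cong-≗ λ s → cong (λ t → [ S t ]) (//-rightDividesʳ x s))

  in-degree : ∀ y → ∑[ z < n ] [ arc z y ] ≡ ∑[ s < n ] [ S s ]
  in-degree y = trans (sym (∑-reindex (_\\ y) (y //_) (λ z → [y//x]\\y≈x (toGroup G) z y)
                                      (λ s → y//[x\\y]≈x (toGroup G) s y) (λ z → [ arc z y ])))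
                      (sum-cong-≗ λ s → cong (λ t → [ S t ]) (y//[x\\y]≈x (toGroup G) s y))

  paths₂ : ∀ x y → ∑[ z < n ] ([ arc x z ] * [ arc z y ])
                   ≡ ∑[ s < n ] ([ S s ] * [ S ((y ∙ x ⁻¹) ∙ s ⁻¹) ])
  paths₂ x y = trans (sym (∑-∙ʳ x (λ z → [ arc x z ] * [ arc z y ])))
                     (sum-cong-≗ λ s → cong₂ (λ a b → [ S a ] * [ S b ])
                                             (//-rightDividesʳ x s) (y[sx]⁻¹≡[yx⁻¹]s⁻¹ s))
    where
    y[sx]⁻¹≡[yx⁻¹]s⁻¹ : ∀ s → y ∙ (s ∙ x) ⁻¹ ≡ (y ∙ x ⁻¹) ∙ s ⁻¹
    y[sx]⁻¹≡[yx⁻¹]s⁻¹ s = trans (cong (y ∙_) (⁻¹-anti-homo-∙ s x)) (sym (assoc y (x ⁻¹) (s ⁻¹)))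

module AutAction {m d} (N : FinGroup m) (H : FinGroup d) (θ : Fin d → Fin m → Fin m)
                 (act : IsAutAction N H θ) where
  open FinGroup N
  open FinGroup H using () renaming (_∙_ to _∙ₕ_; ε to εₕ; _⁻¹ to _⁻¹ₕ)
  module N = Group (toGroup N)
  module H = Group (toGroup H)
  module θ (h : Fin d) = GroupMorphisms.IsGroupIsomorphism (proj₁ act h)

  θ-∘ : ∀ h h' n → θ (h ∙ₕ h') n ≡ θ h (θ h' n)
  θ-∘ = proj₂ act

  θ-identity : ∀ n → θ εₕ n ≡ n
  θ-identity n = θ.injective εₕ (trans (sym (θ-∘ εₕ εₕ n)) (cong (λ g → θ g n) (H.identityˡ εₕ)))

  θ-inverseʳ : ∀ h n → θ h (θ (h ⁻¹ₕ) n) ≡ n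
  θ-inverseʳ h n = trans (sym (θ-∘ h (h ⁻¹ₕ) n)) (trans (cong (λ g → θ g n) (H.inverseʳ h)) (θ-identity n))

  sdIsGroup : IsGroup _≡_ (sdMul N H θ) (ε , εₕ) (sdInv N H θ)
  sdIsGroup = record
    { isMonoid = record
      { isSemigroup = record
        { isMagma = record { isEquivalence = isEquivalence ; ∙-cong = cong₂ (sdMul N H θ) }
        ; assoc   = assoc
        }
      ; identity = identityˡ , identityʳ
      }
    ; inverse = inverseˡ , inverseʳ
    ; ⁻¹-cong = cong (sdInv N H θ)
    }
    where
    open ≡-Reasoning
    assoc : ∀ x y z → sdMul N H θ (sdMul N H θ x y) z ≡ sdMul N H θ x (sdMul N H θ y z)
    assoc (n , h) (n' , h') (n'' , h'') = cong₂ _,_ (begin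
      (n ∙ θ h n') ∙ θ (h ∙ₕ h') n''  ≡⟨ cong ((n ∙ θ h n') ∙_) (θ-∘ h h' n'') ⟩
      (n ∙ θ h n') ∙ θ h (θ h' n'')   ≡⟨ N.assoc n (θ h n') _ ⟩
      n ∙ (θ h n' ∙ θ h (θ h' n''))   ≡⟨ cong (n ∙_) (θ.∙-homo h n' (θ h' n'')) ⟨
      n ∙ θ h (n' ∙ θ h' n'')         ∎) (H.assoc h h' h'')
    identityˡ : ∀ x → sdMul N H θ (ε , εₕ) x ≡ x
    identityˡ (n , h) = cong₂ _,_ (trans (N.identityˡ _) (θ-identity n)) (H.identityˡ h)
    identityʳ : ∀ x → sdMul N H θ x (ε , εₕ) ≡ x
    identityʳ (n , h) = cong₂ _,_ (trans (cong (n ∙_) (θ.ε-homo h)) (N.identityʳ n)) (H.identityʳ h)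
    inverseˡ : ∀ x → sdMul N H θ (sdInv N H θ x) x ≡ (ε , εₕ)
    inverseˡ (n , h) = cong₂ _,_ (begin
      θ (h ⁻¹ₕ) (n ⁻¹) ∙ θ (h ⁻¹ₕ) n  ≡⟨ θ.∙-homo (h ⁻¹ₕ) (n ⁻¹) n ⟨
      θ (h ⁻¹ₕ) (n ⁻¹ ∙ n)           ≡⟨ cong (θ (h ⁻¹ₕ)) (N.inverseˡ n) ⟩
      θ (h ⁻¹ₕ) ε                    ≡⟨ θ.ε-homo (h ⁻¹ₕ) ⟩
      ε                              ∎) (H.inverseˡ h)
    inverseʳ : ∀ x → sdMul N H θ x (sdInv N H θ x) ≡ (ε , εₕ)
    inverseʳ (n , h) = cong₂ _,_ (trans (cong (n ∙_) (θ-inverseʳ h (n ⁻¹))) (N.inverseʳ n)) (H.inverseʳ h)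

  -- Transported along remQuot, so that cayleyArcFin becomes the Cayley digraph of a FinGroup.
  semidirectProduct : FinGroup (m ℕ.* d)
  semidirectProduct = finGroupVia *↔× sdIsGroup

module SemidirectCayley {m d} (N : FinGroup m) (H : FinGroup d) (θ : Fin d → Fin m → Fin m)
                        (act : IsAutAction N H θ) (N₁ : Subset m) where
  open FinGroup N
  open FinGroup H using () renaming (_⁻¹ to _⁻¹ₕ)
  open AutAction N H θ act
  open FinGroup semidirectProduct using () renaming (_∙_ to _∙G_; _⁻¹ to _⁻¹G)
  open Group (toGroup N) using (_//_; _\\_)
  open Group (toGroup H) using () renaming (_//_ to _//ₕ_; _\\_ to _\\ₕ_)
  open LoopProperties (GroupProperties.loop (toGroup N)) using (x//ε≈x)

  S : Fin (m ℕ.* d) → Bool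
  S s = inN₁×H N₁ (remQuot {m} d s)

  open CayleyDigraph semidirectProduct S

  cayleyArcFin≡arc : ∀ i j → cayleyArcFin N H θ N₁ i j ≡ arc i j
  cayleyArcFin≡arc i j = cong (inN₁×H N₁) (sym (to-∙-⁻¹ *↔× sdIsGroup i j))

  [N₁] : Fin m → ℤ
  [N₁] n = [ lookup N₁ n ]

  |N₁| : ℤ
  |N₁| = ∑[ n < m ] [N₁] n

  |S|≡d|N₁| : ∑[ s < m ℕ.* d ] [ S s ] ≡ + d * |N₁|
  |S|≡d|N₁| = begin
    ∑[ s < m ℕ.* d ] [ S s ]      ≡⟨ ∑-remQuot m d (λ p → [N₁] (proj₁ p)) ⟩
    ∑[ n < m ] ∑[ h < d ] [N₁] n  ≡⟨ sum-cong-≗ (λ n → ∑-const d ([N₁] n)) ⟩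
    ∑[ n < m ] (+ d * [N₁] n)     ≡⟨ *-distribˡ-sum (+ d) [N₁] ⟨
    + d * |N₁|                    ∎
    where open ≡-Reasoning

  flatCoeff≡∑ : ∀ n → flatCoeff θ N₁ n ≡ ∑[ h < d ] ∑[ u < m ] ([N₁] u * [ ⌊ θ h u ≟ n ⌋ ])
  flatCoeff≡∑ n = trans (Σℤ≡sum (λ h → + count (N₁∩θ[h]⁻¹n h))) (sum-cong-≗ λ h →
    trans (count≡∑ (N₁∩θ[h]⁻¹n h)) (sum-cong-≗ λ u → [∧]≡[]*[] (lookup N₁ u) ⌊ θ h u ≟ n ⌋))
    where
    N₁∩θ[h]⁻¹n : Fin d → Fin m → Bool
    N₁∩θ[h]⁻¹n h u = lookup N₁ u ∧ ⌊ θ h u ≟ n ⌋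

  ∑-*-flatCoeff : ∀ (F : Fin m → ℤ) →
                  ∑[ n < m ] (F n * flatCoeff θ N₁ n) ≡ ∑[ h < d ] ∑[ u < m ] ([N₁] u * F (θ h u))
  ∑-*-flatCoeff F = begin
    ∑[ n < m ] (F n * flatCoeff θ N₁ n)
      ≡⟨ sum-cong-≗ (λ n → trans (cong (F n *_) (flatCoeff≡∑ n))
           (trans (*-distribˡ-sum (F n) (λ h → ∑[ u < m ] ([N₁] u * [ ⌊ θ h u ≟ n ⌋ ])))
                  (sum-cong-≗ λ h → *-distribˡ-sum (F n) (λ u → [N₁] u * [ ⌊ θ h u ≟ n ⌋ ])))) ⟩
    ∑[ n < m ] ∑[ h < d ] ∑[ u < m ] term h u n
      ≡⟨ trans (∑-comm (λ n h → ∑[ u < m ] term h u n)) (sum-cong-≗ λ h → ∑-comm (λ n u → term h u n)) ⟩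
    ∑[ h < d ] ∑[ u < m ] ∑[ n < m ] term h u n
      ≡⟨ sum-cong-≗ (λ h → sum-cong-≗ λ u → ∑-term h u) ⟩
    ∑[ h < d ] ∑[ u < m ] ([N₁] u * F (θ h u))
      ∎
    where
    open ≡-Reasoning
    term : Fin d → Fin m → Fin m → ℤ
    term h u n = F n * ([N₁] u * [ ⌊ θ h u ≟ n ⌋ ])
    ∑-term : ∀ h u → ∑[ n < m ] term h u n ≡ [N₁] u * F (θ h u)
    ∑-term h u = begin
      ∑[ n < m ] term h u n
        ≡⟨ sum-cong-≗ (λ n → a*[b*c]≡b*[c*a] (F n) ([N₁] u) [ ⌊ θ h u ≟ n ⌋ ]) ⟩
      ∑[ n < m ] ([N₁] u * ([ ⌊ θ h u ≟ n ⌋ ] * F n))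
        ≡⟨ *-distribˡ-sum ([N₁] u) (λ n → [ ⌊ θ h u ≟ n ⌋ ] * F n) ⟨
      [N₁] u * ∑[ n < m ] ([ ⌊ θ h u ≟ n ⌋ ] * F n)
        ≡⟨ cong ([N₁] u *_) (∑-indicator (θ h u ≟_) (θ h u) (λ n → mk⇔ sym sym) F) ⟩
      [N₁] u * F (θ h u)
        ∎

  ∑-flatCoeff : ∑[ n < m ] flatCoeff θ N₁ n ≡ + d * |N₁|
  ∑-flatCoeff = begin
    ∑[ n < m ] flatCoeff θ N₁ n
      ≡⟨ sum-cong-≗ (λ n → *-identityˡ (flatCoeff θ N₁ n)) ⟨
    ∑[ n < m ] (+ 1 * flatCoeff θ N₁ n)
      ≡⟨ ∑-*-flatCoeff (λ _ → + 1) ⟩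
    ∑[ h < d ] ∑[ u < m ] ([N₁] u * + 1)
      ≡⟨ cong (λ t → ∑[ h < d ] t) (sum-cong-≗ λ u → *-identityʳ ([N₁] u)) ⟩
    ∑[ h < d ] |N₁|
      ≡⟨ ∑-const d |N₁| ⟩
    + d * |N₁|
      ∎
    where open ≡-Reasoning

  N₁*N₁♭ : Fin m → ℤ
  N₁*N₁♭ c = ∑[ n < m ] ([N₁] (c // n) * flatCoeff θ N₁ n)

  ∑-[N₁]-// : ∀ c → ∑[ n < m ] [N₁] (c // n) ≡ |N₁|
  ∑-[N₁]-// c =
    ∑-reindex (c //_) (_\\ c) (λ v → y//[x\\y]≈x (toGroup N) v c) (λ n → [y//x]\\y≈x (toGroup N) n c) [N₁]

  paths₂≡N₁*N₁♭ : ∀ x y → ∑[ z < m ℕ.* d ] ([ arc x z ] * [ arc z y ])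
                          ≡ N₁*N₁♭ (proj₁ (remQuot {m} d (y ∙G x ⁻¹G)))
  paths₂≡N₁*N₁♭ x y = begin
    ∑[ z < m ℕ.* d ] ([ arc x z ] * [ arc z y ])
      ≡⟨ paths₂ x y ⟩
    ∑[ s < m ℕ.* d ] ([ S s ] * [ S (g ∙G s ⁻¹G) ])
      ≡⟨ sum-cong-≗ (λ s → cong (λ p → [ S s ] * [ inN₁×H N₁ p ]) (to-∙-⁻¹ *↔× sdIsGroup s g)) ⟩
    ∑[ s < m ℕ.* d ] ([ S s ] * [ inN₁×H N₁ (sdMul N H θ (remQuot {m} d g) (sdInv N H θ (remQuot {m} d s))) ])
      ≡⟨ trans (∑-remQuot m d (λ p → term (proj₁ p) (proj₂ p))) (∑-comm term) ⟩
    ∑[ k < d ] ∑[ u < m ] ([N₁] u * [N₁] (c ∙ θ l (θ (k ⁻¹ₕ) (u ⁻¹))))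
      ≡⟨ sum-cong-≗ (λ k → sum-cong-≗ λ u → cong (λ v → [N₁] u * [N₁] (c ∙ v)) (θ-shift k u)) ⟩
    ∑[ k < d ] ∑[ u < m ] ([N₁] u * [N₁] (c // θ (l //ₕ k) u))
      ≡⟨ ∑-reindex (l //ₕ_) (_\\ₕ l) (λ h → y//[x\\y]≈x (toGroup H) h l)
                   (λ k → [y//x]\\y≈x (toGroup H) k l) (λ h → ∑[ u < m ] ([N₁] u * [N₁] (c // θ h u))) ⟩
    ∑[ h < d ] ∑[ u < m ] ([N₁] u * [N₁] (c // θ h u))
      ≡⟨ ∑-*-flatCoeff (λ n → [N₁] (c // n)) ⟨
    N₁*N₁♭ c
      ∎
    where
    open ≡-Reasoning
    g = y ∙G x ⁻¹G
    c = proj₁ (remQuot {m} d g)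
    l = proj₂ (remQuot {m} d g)
    term : Fin m → Fin d → ℤ
    term u k = [N₁] u * [N₁] (c ∙ θ l (θ (k ⁻¹ₕ) (u ⁻¹)))
    θ-shift : ∀ k u → θ l (θ (k ⁻¹ₕ) (u ⁻¹)) ≡ θ (l //ₕ k) u ⁻¹
    θ-shift k u = trans (sym (θ-∘ l (k ⁻¹ₕ) (u ⁻¹))) (θ.⁻¹-homo (l //ₕ k) u)

  [cayleyArcFin] : Fin (m ℕ.* d) → Fin (m ℕ.* d) → ℤ
  [cayleyArcFin] i j = [ cayleyArcFin N H θ N₁ i j ]

  cayleyArcFin-irreflexive : ε ∉ N₁ → ∀ i → cayleyArcFin N H θ N₁ i i ≡ false
  cayleyArcFin-irreflexive ε∉N₁ i = trans (cayleyArcFin≡arc i i) (arc-irreflexive S-ε i)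
    where
    S-ε : S (FinGroup.ε semidirectProduct) ≡ false
    S-ε = trans (cong (inN₁×H N₁) (to-ε *↔× sdIsGroup)) (∉⇒lookup≡false ε∉N₁)

  Σ-out-degree : ∀ i → Σℤ ([cayleyArcFin] i) ≡ + d * |N₁|
  Σ-out-degree i = begin
    Σℤ ([cayleyArcFin] i)                ≡⟨ Σℤ≡sum ([cayleyArcFin] i) ⟩
    ∑[ j < m ℕ.* d ] [cayleyArcFin] i j  ≡⟨ sum-cong-≗ (λ j → cong [_] (cayleyArcFin≡arc i j)) ⟩
    ∑[ j < m ℕ.* d ] [ arc i j ]         ≡⟨ out-degree i ⟩
    ∑[ s < m ℕ.* d ] [ S s ]             ≡⟨ |S|≡d|N₁| ⟩
    + d * |N₁|                           ∎
    where open ≡-Reasoning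

  Σ-in-degree : ∀ j → Σℤ (λ i → [cayleyArcFin] i j) ≡ + d * |N₁|
  Σ-in-degree j = begin
    Σℤ (λ i → [cayleyArcFin] i j)        ≡⟨ Σℤ≡sum (λ i → [cayleyArcFin] i j) ⟩
    ∑[ i < m ℕ.* d ] [cayleyArcFin] i j  ≡⟨ sum-cong-≗ (λ i → cong [_] (cayleyArcFin≡arc i j)) ⟩
    ∑[ i < m ℕ.* d ] [ arc i j ]         ≡⟨ in-degree j ⟩
    ∑[ s < m ℕ.* d ] [ S s ]             ≡⟨ |S|≡d|N₁| ⟩
    + d * |N₁|                           ∎
    where open ≡-Reasoning

  Σ-paths₂ : ∀ i j → Σℤ (λ k → [cayleyArcFin] i k * [cayleyArcFin] k j)
                     ≡ N₁*N₁♭ (proj₁ (sdMul N H θ (remQuot {m} d j) (sdInv N H θ (remQuot {m} d i))))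
  Σ-paths₂ i j = begin
    Σℤ (λ k → [cayleyArcFin] i k * [cayleyArcFin] k j)
      ≡⟨ Σℤ≡sum (λ k → [cayleyArcFin] i k * [cayleyArcFin] k j) ⟩
    ∑[ k < m ℕ.* d ] ([cayleyArcFin] i k * [cayleyArcFin] k j)
      ≡⟨ sum-cong-≗ (λ k → cong₂ (λ a b → [ a ] * [ b ]) (cayleyArcFin≡arc i k) (cayleyArcFin≡arc k j)) ⟩
    ∑[ k < m ℕ.* d ] ([ arc i k ] * [ arc k j ])
      ≡⟨ paths₂≡N₁*N₁♭ i j ⟩
    N₁*N₁♭ (proj₁ (remQuot {m} d (j ∙G i ⁻¹G)))
      ≡⟨ cong (λ p → N₁*N₁♭ (proj₁ p)) (to-∙-⁻¹ *↔× sdIsGroup i j) ⟩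
    N₁*N₁♭ (proj₁ (sdMul N H θ (remQuot {m} d j) (sdInv N H θ (remQuot {m} d i))))
      ∎
    where open ≡-Reasoning

  module _ (x₁ x₂ : ℤ) (flatCoeff≡ : ∀ n → flatCoeff θ N₁ n ≡ x₁ + x₂ * [ ⌊ n ≟ ε ⌋ ]) where

    N₁*N₁♭≡ : ∀ c → N₁*N₁♭ c ≡ x₁ * |N₁| + x₂ * [N₁] c
    N₁*N₁♭≡ c = begin
      ∑[ n < m ] ([N₁] (c // n) * flatCoeff θ N₁ n)
        ≡⟨ sum-cong-≗ (λ n → trans (cong ([N₁] (c // n) *_) (flatCoeff≡ n))
                                   (a*[b+c*d]≡b*a+c*[d*a] ([N₁] (c // n)) x₁ x₂ _)) ⟩
      ∑[ n < m ] (x₁ * [N₁] (c // n) + x₂ * ([ ⌊ n ≟ ε ⌋ ] * [N₁] (c // n)))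
        ≡⟨ ∑-distrib-+ (λ n → x₁ * [N₁] (c // n)) (λ n → x₂ * ([ ⌊ n ≟ ε ⌋ ] * [N₁] (c // n))) ⟩
      ∑[ n < m ] (x₁ * [N₁] (c // n)) + ∑[ n < m ] (x₂ * ([ ⌊ n ≟ ε ⌋ ] * [N₁] (c // n)))
        ≡⟨ cong₂ _+_ (*-distribˡ-sum x₁ (λ n → [N₁] (c // n)))
                     (*-distribˡ-sum x₂ (λ n → [ ⌊ n ≟ ε ⌋ ] * [N₁] (c // n))) ⟨
      x₁ * ∑[ n < m ] [N₁] (c // n) + x₂ * ∑[ n < m ] ([ ⌊ n ≟ ε ⌋ ] * [N₁] (c // n))
        ≡⟨ cong₂ (λ a b → x₁ * a + x₂ * b) (∑-[N₁]-// c) (∑-δ ε (λ n → [N₁] (c // n))) ⟩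
      x₁ * |N₁| + x₂ * [N₁] (c // ε)
        ≡⟨ cong (λ v → x₁ * |N₁| + x₂ * [N₁] v) (x//ε≈x c) ⟩
      x₁ * |N₁| + x₂ * [N₁] c
        ∎
      where open ≡-Reasoning

    x₁m+x₂≡d|N₁| : x₁ * + m + x₂ ≡ + d * |N₁|
    x₁m+x₂≡d|N₁| = begin
      x₁ * + m + x₂
        ≡⟨ cong₂ _+_ (trans (*-comm x₁ (+ m)) (sym (∑-const m x₁)))
                     (trans (sym (*-identityʳ x₂)) (cong (x₂ *_) (sym (∑-δ ε (λ _ → + 1))))) ⟩
      ∑[ n < m ] x₁ + x₂ * ∑[ n < m ] ([ ⌊ n ≟ ε ⌋ ] * + 1)
        ≡⟨ cong (λ t → ∑[ n < m ] x₁ + t) (*-distribˡ-sum x₂ (λ n → [ ⌊ n ≟ ε ⌋ ] * + 1)) ⟩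
      ∑[ n < m ] x₁ + ∑[ n < m ] (x₂ * ([ ⌊ n ≟ ε ⌋ ] * + 1))
        ≡⟨ ∑-distrib-+ (λ _ → x₁) (λ n → x₂ * ([ ⌊ n ≟ ε ⌋ ] * + 1)) ⟨
      ∑[ n < m ] (x₁ + x₂ * ([ ⌊ n ≟ ε ⌋ ] * + 1))
        ≡⟨ sum-cong-≗ (λ n → trans (cong (λ t → x₁ + x₂ * t) (*-identityʳ _)) (sym (flatCoeff≡ n))) ⟩
      ∑[ n < m ] flatCoeff θ N₁ n
        ≡⟨ ∑-flatCoeff ⟩
      + d * |N₁|
        ∎
      where open ≡-Reasoning

    module _ .{{_ : NonZero d}} (0≤x₁ : + 0 ≤ x₁) where

      μ : ℤ
      μ = (x₁ * (x₁ * + m + x₂)) / + d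

      μ≡x₁|N₁| : μ ≡ x₁ * |N₁|
      μ≡x₁|N₁| = begin
        (x₁ * (x₁ * + m + x₂)) / + d
          ≡⟨ cong (λ k → (x₁ * k) / + d) x₁m+x₂≡d|N₁| ⟩
        (x₁ * (+ d * |N₁|)) / + d
          ≡⟨ cong (λ k → (x₁ * (+ d * k)) / + d) (count≡∑ (lookup N₁)) ⟨
        (x₁ * (+ d * + count (lookup N₁))) / + d
          ≡⟨ i*[d*b]/d≡i*b d (count (lookup N₁)) 0≤x₁ ⟩
        x₁ * + count (lookup N₁)
          ≡⟨ cong (x₁ *_) (count≡∑ (lookup N₁)) ⟩
        x₁ * |N₁|
          ∎
        where open ≡-Reasoning

      Σ-paths₂≡μJ+x₂A : ∀ i j → let I = [ ⌊ i ≟ j ⌋ ] ; A = [cayleyArcFin] i j in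
                        Σℤ (λ k → [cayleyArcFin] i k * [cayleyArcFin] k j)
                        ≡ μ * I + (x₂ + μ) * A + μ * (+ 1 - I - A)
      Σ-paths₂≡μJ+x₂A i j = begin
        Σℤ (λ k → [cayleyArcFin] i k * [cayleyArcFin] k j)  ≡⟨ Σ-paths₂ i j ⟩
        N₁*N₁♭ _                                          ≡⟨ N₁*N₁♭≡ _ ⟩
        x₁ * |N₁| + x₂ * A                                ≡⟨ cong (λ t → t + x₂ * A) μ≡x₁|N₁| ⟨
        μ + x₂ * A                                        ≡⟨ tI+[x+t]A+t[1-I-A]≡t+xA μ x₂ I A ⟨
        μ * I + (x₂ + μ) * A + μ * (+ 1 - I - A)          ∎
        where
        open ≡-Reasoning
        I = [ ⌊ i ≟ j ⌋ ]
        A = [cayleyArcFin] i j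

mainTheorem7 : (m d : ℕ) .{{_ : NonZero d}} (N : FinGroup m) (H : FinGroup d)
    (θ : Fin d → Fin m → Fin m) → IsAutAction N H θ →
    (N₁ : Subset m) → FinGroup.ε N ∉ N₁ →
    (x₁ x₂ : ℤ) →
    (∀ n → flatCoeff θ N₁ n ≡ x₁ + x₂ * [ ⌊ n ≟ FinGroup.ε N ⌋ ]) →
    x₁ < + d → + 0 < x₁ → x₂ < + 0 →
    IsDSRG (m ℕ.* d) (cayleyArcFin N H θ N₁)
      (x₁ * + m + x₂)
      ((x₁ * (x₁ * + m + x₂)) / + d)
      (x₂ + (x₁ * (x₁ * + m + x₂)) / + d)
      ((x₁ * (x₁ * + m + x₂)) / + d)
mainTheorem7 m d N H θ act N₁ ε∉N₁ x₁ x₂ flatCoeff≡ _ 0<x₁ _ = record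
  { zeroDiag = cayleyArcFin-irreflexive ε∉N₁
  ; JA≡kJ    = λ j → trans (Σ-in-degree j) (sym (x₁m+x₂≡d|N₁| x₁ x₂ flatCoeff≡))
  ; AJ≡kJ    = λ i → trans (Σ-out-degree i) (sym (x₁m+x₂≡d|N₁| x₁ x₂ flatCoeff≡))
  ; A²       = Σ-paths₂≡μJ+x₂A x₁ x₂ flatCoeff≡ (<⇒≤ 0<x₁)
  }
  where open SemidirectCayley N H θ act N₁
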